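{- Let $A,B$ be nonempty sets with $A$ finite, and assume $n>|A|+1$. Let $f\colon A^n\to B$. Then the following are equivalent: (i) $f$ is totally symmetric and determined by the order of first occurrence; (ii) $f$ is $2$-set-transitive and determined by the order of first occurrence; (iii) $f$ is determined by the order of first occurrence and for all $2$-element subsets $I,J$ of $\{1,\dots,n\}$ there exists a bijection $\pi_{IJ}\colon\{1,\dots,n-1\}\to\{1,\dots,n-1\}$ such that $\pi_{IJ}(\min J)=\min I$ and $f(\mathbf{a}\delta_I)=f(\mathbf{a}\pi_{IJ}\delta_J)$ for all $\mathbf{a}\in A^{n-1}$; (iv) $f$ is determined by $\mathrm{supp}$.
   Context: For $\mathbf{a}=(a_1,\dots,a_n)\in A^n$ and $\tau\colon\{1,\dots,m\}\to\{1,\dots,n\}$, $\mathbf{a}\tau=(a_{\tau(1)},\dots,a_{\tau(m)})$; $\mathbf{a}\pi_{IJ}\delta_J$ means $(\mathbf{a}\pi_{IJ})\delta_J$. For a $2$-element subset $I\subseteq\{1,\dots,n\}$, $\delta_I\colon\{1,\dots,n\}\to\{1,\dots,n-1\}$ is given by $\delta_I(i)=i$ if $i<\max I$, $\delta_I(i)=\min I$ if $i=\max I$, $\delta_I(i)=i-1$ if $i>\max I$. $A^*=\bigcup_{r\ge0}A^r$; $A^r_{\neq}$ is the set of tuples in $A^r$ with pairwise distinct entries; $A^\sharp=\bigcup_{r\ge0}A^r_{\neq}$. $\mathrm{ofo}\colon A^*\to A^\sharp$ maps a tuple to the tuple of its distinct entries in order of first occurrence. $f$ is determined by the order of first occurrence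 if $f=f^*\circ\mathrm{ofo}|_{A^n}$ for some $f^*\colon A^\sharp\to B$. $\mathrm{supp}(a_1,\dots,a_n)=\{a_1,\dots,a_n\}$, and $f$ is determined by $\mathrm{supp}$ if $f=f'\circ\mathrm{supp}|_{A^n}$ for some $f'\colon\mathcal P(A)\to B$. $f$ is invariant under $\sigma\in S_n$ if $f(\mathbf{a})=f(\mathbf{a}\sigma)$ for all $\mathbf{a}\in A^n$; the set of such $\sigma$ is the invariance group $\mathrm{Inv} f$. $f$ is totally symmetric if $\mathrm{Inv}f=S_n$, and $2$-set-transitive if $\mathrm{Inv} f$ acts transitively on the $2$-element subsets of $\{1,\dots,n\}$. -}

module Defs where

open import Data.Nat using (ℕ; zero; suc)
open import Data.Fin using (Fin; _<_; punchOut; _≟_)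
open import Data.Fin.Properties using (any?)
open import Data.Fin.Subset using (Subset)
open import Data.Fin.Permutation using (Permutation′; _⟨$⟩ʳ_)
open import Data.Vec using (tabulate)
open import Data.Vec.Functional using (toList)
open import Data.List using (List; deduplicate)
open import Data.List.Relation.Unary.Unique.Propositional using (Unique)
import Data.List.Relation.Unary.Unique.DecPropositional.Properties as UP
open import Data.Product using (Σ; ∃; _×_; _,_; proj₁; proj₂)
open import Data.Sum using (_⊎_)
open import Function using (_∘_)
open import Function.Bundles using (_↔_; Inverse)
open import Relation.Nullary using (Dec; yes; no; does; map′)
open import Relation.Binary.Definitions using (DecidableEquality)
open import Relation.Binary.PropositionalEquality using (_≡_; _≢_; refl; sym; trans; cong)

-- Finite sets: A is finite of cardinality k, witnessed by A ↔ Fin k.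
-- Decidable equality of A is derived from the bijection.

decEqFin : ∀ {A : Set} {k : ℕ} → A ↔ Fin k → DecidableEquality A
decEqFin e x y = map′ inj (cong to) (to x ≟ to y)
  where
  open Inverse e
  inj : to x ≡ to y → x ≡ y
  inj p = trans (sym (inverseʳ refl)) (trans (cong from p) (inverseʳ refl))

-- Tuples: A^n is  Fin n → A ;  𝐚τ = 𝐚 ∘ τ.

-- A^♯ : tuples (lists) with pairwise distinct entries.
-- The distinctness proof is irrelevant, so elements are equal iff lists are.
record Distinct (A : Set) : Set where
  constructor ⟨_∣_⟩
  field
    entries   : List A
    .distinct : Unique entries

ofo : ∀ {A : Set} {k : ℕ} → A ↔ Fin k → ∀ {n} → (Fin n → A) → Distinct A
ofo e a = ⟨ deduplicate (decEqFin e) (toList a) ∣ UP.deduplicate-! (decEqFin e) (toList a) ⟩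

DeterminedByOfo : ∀ {A B : Set} {k : ℕ} → A ↔ Fin k → ∀ {n} → ((Fin n → A) → B) → Set
DeterminedByOfo {A} {B} e f = Σ (Distinct A → B) λ f* → ∀ a → f a ≡ f* (ofo e a)

-- supp : A^n → P(A), where P(A) is represented (via A ↔ Fin k) by Subset k
supp : ∀ {A : Set} {k : ℕ} → A ↔ Fin k → ∀ {n} → (Fin n → A) → Subset k
supp e a = tabulate λ j → does (any? λ i → decEqFin e (a i) (Inverse.from e j))

DeterminedBySupp : ∀ {A B : Set} {k : ℕ} → A ↔ Fin k → ∀ {n} → ((Fin n → A) → B) → Set
DeterminedBySupp {A} {B} {k} e f = Σ (Subset k → B) λ f' → ∀ a → f a ≡ f' (supp e a)

InvariantUnder : ∀ {A B : Set} {n} → ((Fin n → A) → B) → Permutation′ n → Set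
InvariantUnder f σ = ∀ a → f a ≡ f (a ∘ (σ ⟨$⟩ʳ_))

TotallySymmetric : ∀ {A B : Set} {n} → ((Fin n → A) → B) → Set
TotallySymmetric {n = n} f = (σ : Permutation′ n) → InvariantUnder f σ

TwoSubset : ℕ → Set
TwoSubset n = Σ (Fin n × Fin n) λ p → proj₁ p < proj₂ p

minI maxI : ∀ {n} → TwoSubset n → Fin n
minI I = proj₁ (proj₁ I)
maxI I = proj₂ (proj₁ I)

MapsOnto : ∀ {n} → Permutation′ n → TwoSubset n → TwoSubset n → Set
MapsOnto σ I J =
  ((σ ⟨$⟩ʳ minI I) ≡ minI J × (σ ⟨$⟩ʳ maxI I) ≡ maxI J)
  ⊎ ((σ ⟨$⟩ʳ minI I) ≡ maxI J × (σ ⟨$⟩ʳ maxI I) ≡ minI J)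

TwoSetTransitive : ∀ {A B : Set} {n} → ((Fin n → A) → B) → Set
TwoSetTransitive {n = n} f =
  (I J : TwoSubset n) → Σ (Permutation′ n) λ σ → InvariantUnder f σ × MapsOnto σ I J

-- δ_I : {1..n} → {1..n-1}  (here n = suc m):
--   δ_I(i) = i if i < max I, = min I if i = max I, = i - 1 if i > max I.
-- punchOut {max I} removes max I: it sends j < max I to j, j > max I to j - 1.

minI≢maxI : ∀ {n} (I : TwoSubset n) → maxI I ≢ minI I
minI≢maxI ((i , .i) , i<i) refl = Data.Nat.Properties.<-irrefl refl i<i
  where import Data.Nat.Properties

δ : ∀ {m} → TwoSubset (suc m) → Fin (suc m) → Fin m
δ I i with maxI I ≟ i
... | yes _  = punchOut (minI≢maxI I)
... | no mx≢i = punchOut mx≢i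

-- Let f be determined by the order of first occurrence and invariant under a
-- permutation σ of the n positions that sends the first position to the last.
-- For a tuple x ∷ w whose head x also occurs in w, permuting by σ⁻¹ moves x to
-- the last position, where it no longer affects the order of first occurrence;
-- hence f (x ∷ w) = f (y ∷ w) for all entries x, y of w. As |A| ≤ n - 1, every
-- list of values can be padded to such a w without changing its order of first
-- occurrence, so moving a value that already occurs to the front never changes
-- f. Prepending to a list another one with the same entries, and deduplicating,
-- then shows that f depends only on the support. Condition (i) provides σ
-- directly, (ii) provides σ or σ ∘ σ, and (iii) provides one on tuples of length
-- n - 1 (this is where |A| + 1 < n is needed), taking for I the last two
-- positions and for J the first and the last. Conversely, the support is
-- invariant under surjective reindexings, which gives (i)–(iii) from (iv).
module Submission where

open import Defs
open import Data.Nat using (ℕ; zero; suc; _+_; _∸_; _≤_; _<_; z≤n; s≤s)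
open import Data.Nat.Properties using (≤-trans; m≤n⇒m≤1+n)
open import Data.Fin as Fin using (Fin; zero; suc; fromℕ; inject₁; punchIn; punchOut)
open import Data.Fin.Properties
  using (any?; injective⇒≤; fromℕ≢inject₁; 0≢1+n; punchOut-cong; punchOut-punchIn; punchInᵢ≢i; <⇒≢)
open import Data.Fin.Permutation
  using (Permutation′; _⟨$⟩ʳ_; _⟨$⟩ˡ_; inverseˡ; inverseʳ; transpose; _∘ₚ_)
import Data.Fin.Permutation.Components as PC
open import Data.Fin.Subset using (Subset)
open import Data.Vec as Vec using (lookup)
import Data.Vec.Properties as Vec
open import Data.Vec.Functional using (Vector; toList; init; last) renaming (_∷_ to _∷ᵥ_)
open import Data.List as List using (List; []; _∷_; _++_; _∷ʳ_; [_]; filter; length; deduplicate)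
open import Data.List.Properties
  using (filter-all; filter-accept; filter-reject; filter-++; ++-assoc; ++-identityʳ; tabulate-cong; tabulate-lookup)
open import Data.List.Membership.Propositional using (_∈_; _∉_)
open import Data.List.Membership.Propositional.Properties
  using ( ∈-tabulate⁺; ∈-tabulate⁻; ∈-filter⁺; ∈-filter⁻; ∈-++⁺ˡ; ∈-++⁺ʳ
        ; ∈-deduplicate⁺; ∈-deduplicate⁻; deduplicate-∈⇔; ∈-lookup)
import Data.List.Membership.DecPropositional as DecMembership
open import Data.List.Relation.Unary.Any using (here; there)
import Data.List.Relation.Unary.All as All
open import Data.List.Relation.Unary.AllPairs using ([]; _∷_)
open import Data.List.Relation.Unary.Unique.Propositional using (Unique)
open import Data.List.Relation.Unary.Unique.DecPropositional.Properties using (deduplicate-!)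
open import Data.List.Relation.Binary.Subset.Propositional using (_⊆_)
open import Data.List.Relation.Binary.BagAndSetEquality using (_∼[_]_; set)
open import Data.Bool using (T)
open import Data.Product as Product using (Σ; ∃; _×_; _,_; proj₁; proj₂)
open import Data.Sum using (inj₁; inj₂)
open import Function using (_∘_; _⇔_; mk⇔; Equivalence; Injection)
open import Function.Bundles using (_↔_; Inverse)
open import Function.Definitions using (Injective; StrictlySurjective)
open import Function.Properties.Inverse using (↔⇒↣)
open import Function.Properties.Equivalence using () renaming (refl to ⇔-refl; sym to ⇔-sym; trans to ⇔-trans)
open import Relation.Nullary using (Dec; yes; no; does; ¬_; ¬?)
open import Relation.Nullary.Decidable using (does-⇔; T?)
open import Relation.Nullary.Negation using (contradiction)
open import Relation.Binary.Definitions using (DecidableEquality)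
open import Relation.Binary.PropositionalEquality
  using (_≡_; _≢_; _≗_; refl; sym; trans; cong; subst; module ≡-Reasoning)

open ≡-Reasoning

private
  variable
    A B : Set
    k n : ℕ

toList-init-last : (a : Vector A (suc n)) → toList a ≡ toList (init a) ∷ʳ last a
toList-init-last {n = zero}  a = refl
toList-init-last {n = suc n} a = cong (a zero ∷_) (toList-init-last (a ∘ suc))

∈-toList-init : (a : Vector A (suc n)) {i : Fin (suc n)} → i ≢ fromℕ n → a i ∈ toList (init a)
∈-toList-init {n = zero}  a {zero}  i≢last = contradiction refl i≢last
∈-toList-init {n = suc n} a {zero}  _      = here refl
∈-toList-init {n = suc n} a {suc i} i≢last = there (∈-toList-init (a ∘ suc) (i≢last ∘ cong suc))

∈-toList⇔ : {a : Vector A n} {z : A} → z ∈ toList a ⇔ ∃ λ i → a i ≡ z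
∈-toList⇔ = mk⇔ (Product.map₂ sym ∘ ∈-tabulate⁻) (λ { (i , refl) → ∈-tabulate⁺ i })

toList-∘-surjective : (a : Vector A n) {m : ℕ} {g : Fin m → Fin n} →
                      StrictlySurjective _≡_ g → toList (a ∘ g) ∼[ set ] toList a
toList-∘-surjective a {g = g} g-surj = mk⇔
  (λ z∈ → let i , p = Equivalence.to ∈-toList⇔ z∈ in Equivalence.from ∈-toList⇔ (g i , p))
  (λ z∈ → let i , p = Equivalence.to ∈-toList⇔ z∈ ; j , gj≡i = g-surj i in
          Equivalence.from ∈-toList⇔ (j , trans (cong a gj≡i) p))

padTo : (n : ℕ) → A → List A → Vector A n
padTo n       d []       = λ _ → d
padTo zero    d (x ∷ xs) = λ ()
padTo (suc n) d (x ∷ xs) = x ∷ᵥ padTo n d xs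

toList-padTo : (d : A) (xs : List A) → length xs ≤ n →
               toList (padTo n d xs) ≡ xs ++ toList {n = n ∸ length xs} (λ _ → d)
toList-padTo d []       _         = refl
toList-padTo d (x ∷ xs) (s≤s len) = cong (x ∷_) (toList-padTo d xs len)

lookup-injective : {xs : List A} → Unique xs → Injective _≡_ _≡_ (List.lookup xs)
lookup-injective (x∉xs ∷ u) {zero}  {zero}  _  = refl
lookup-injective (x∉xs ∷ u) {zero}  {suc j} eq = contradiction eq (All.lookup x∉xs (∈-lookup j))
lookup-injective (x∉xs ∷ u) {suc i} {zero}  eq = contradiction (sym eq) (All.lookup x∉xs (∈-lookup i))
lookup-injective (x∉xs ∷ u) {suc i} {suc j} eq = cong suc (lookup-injective u eq)

unique-length≤ : A ↔ Fin k → {xs : List A} → Unique xs → length xs ≤ k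
unique-length≤ e u = injective⇒≤ (lookup-injective u ∘ Injection.injective (↔⇒↣ e))

⟨∣⟩-cong : {xs ys : List A} → xs ≡ ys →
           .{p : Unique xs} .{q : Unique ys} → ⟨ xs ∣ p ⟩ ≡ ⟨ ys ∣ q ⟩
⟨∣⟩-cong refl = refl

SetInvariant : (List A → B) → Set
SetInvariant {A} Φ = {xs ys : List A} → xs ∼[ set ] ys → Φ xs ≡ Φ ys

T-does⇔ : {P : Set} (P? : Dec P) → T (does P?) ⇔ P
T-does⇔ (yes p) = mk⇔ (λ _ → p) (λ _ → _)
T-does⇔ (no ¬p) = mk⇔ (λ ()) ¬p

≡⇒∼[set] : {xs ys : List A} → xs ≡ ys → xs ∼[ set ] ys
≡⇒∼[set] refl = ⇔-refl

transpose-matchˡ : (i j : Fin n) → PC.transpose i j i ≡ j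
transpose-matchˡ i j with i Fin.≟ i
... | yes _   = refl
... | no i≢i = contradiction refl i≢i

transpose-fix : {i j l : Fin n} → l ≢ i → l ≢ j → PC.transpose i j l ≡ l
transpose-fix {i = i} {j} {l} l≢i l≢j with l Fin.≟ i
... | yes l≡i = contradiction l≡i l≢i
... | no _ with l Fin.≟ j
...   | yes l≡j = contradiction l≡j l≢j
...   | no _    = refl

transpose-injective : (i j : Fin n) → Injective _≡_ _≡_ (PC.transpose i j)
transpose-injective i j eq =
  trans (sym (PC.transpose-inverse j i)) (trans (cong (PC.transpose j i) eq) (PC.transpose-inverse j i))

Sₙ-twoSetTransitive : (I J : TwoSubset n) → Σ (Permutation′ n) λ σ → MapsOnto σ I J
Sₙ-twoSetTransitive I J =
  transpose (minI I) (minI J) ∘ₚ transpose b (maxI J) , inj₁ (minI↦minJ , transpose-matchˡ b (maxI J))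
  where
  b = PC.transpose (minI I) (minI J) (maxI I)

  minJ≢b : minI J ≢ b
  minJ≢b minJ≡b = <⇒≢ (proj₂ I)
    (transpose-injective (minI I) (minI J) (trans (transpose-matchˡ (minI I) (minI J)) minJ≡b))

  minI↦minJ : PC.transpose b (maxI J) (PC.transpose (minI I) (minI J) (minI I)) ≡ minI J
  minI↦minJ = trans (cong (PC.transpose b (maxI J)) (transpose-matchˡ (minI I) (minI J)))
                    (transpose-fix minJ≢b (<⇒≢ (proj₂ J)))

TotallySymmetric⇒TwoSetTransitive : {f : Vector A n → B} → TotallySymmetric f → TwoSetTransitive f
TotallySymmetric⇒TwoSetTransitive f-sym I J =
  let σ , σ-onto = Sₙ-twoSetTransitive I J in σ , f-sym σ , σ-onto

InvariantUnder-∘ₚ : {f : Vector A n → B} {σ τ : Permutation′ n} →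
                    InvariantUnder f σ → InvariantUnder f τ → InvariantUnder f (σ ∘ₚ τ)
InvariantUnder-∘ₚ {τ = τ} σ-inv τ-inv a = trans (τ-inv a) (σ-inv (a ∘ (τ ⟨$⟩ʳ_)))

-- Positions counted from 0: σ maps {0, 1} onto {1, n - 1}; if σ 0 = 1 then σ 1 = n - 1,
-- so σ ∘ σ sends 0 to n - 1.
TwoSetTransitive⇒firstToLast : {m : ℕ} {f : Vector A (3 + m) → B} → TwoSetTransitive f →
                               Σ (Permutation′ (3 + m)) λ σ → InvariantUnder f σ × σ ⟨$⟩ʳ zero ≡ fromℕ (2 + m)
TwoSetTransitive⇒firstToLast f-trans
  with f-trans ((zero , suc zero) , s≤s z≤n) ((suc zero , fromℕ _) , s≤s (s≤s z≤n))
... | σ , σ-inv , inj₂ (σ0≡last , _)   = σ , σ-inv , σ0≡last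
... | σ , σ-inv , inj₁ (σ0≡1 , σ1≡last) =
  σ ∘ₚ σ , InvariantUnder-∘ₚ {σ = σ} {σ} σ-inv σ-inv , trans (cong (σ ⟨$⟩ʳ_) σ0≡1) σ1≡last

inject₁<fromℕ : (i : Fin n) → inject₁ i Fin.< fromℕ n
inject₁<fromℕ zero    = s≤s z≤n
inject₁<fromℕ (suc i) = s≤s (inject₁<fromℕ i)

punchOut-fromℕ : (j : Fin n) (last≢j : fromℕ n ≢ inject₁ j) → punchOut last≢j ≡ j
punchOut-fromℕ {suc n} zero    _       = refl
punchOut-fromℕ {suc n} (suc j) last≢j = cong suc (punchOut-fromℕ j (last≢j ∘ cong suc))

δ-inject₁ : (i : Fin (suc n)) (i<last : i Fin.< fromℕ n) (j : Fin n) →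
            δ ((i , fromℕ n) , i<last) (inject₁ j) ≡ j
δ-inject₁ {n} i i<last j with fromℕ n Fin.≟ inject₁ j
... | yes last≡j = contradiction last≡j fromℕ≢inject₁
... | no last≢j  = punchOut-fromℕ j last≢j

δ-surjective : (I : TwoSubset (suc n)) → StrictlySurjective _≡_ (δ I)
δ-surjective I j = punchIn (maxI I) j , δ-punchIn
  where
  δ-punchIn : δ I (punchIn (maxI I) j) ≡ j
  δ-punchIn with maxI I Fin.≟ punchIn (maxI I) j
  ... | yes max≡ = contradiction (sym max≡) (punchInᵢ≢i (maxI I) j)
  ... | no _     = trans (punchOut-cong (maxI I) refl) (punchOut-punchIn (maxI I))

IdentificationMinorsEquivalent : {A B : Set} {m : ℕ} → (Vector A (suc m) → B) → Set
IdentificationMinorsEquivalent {A} {m = m} f =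
  (I J : TwoSubset (suc m)) → Σ (Permutation′ m) λ π →
    (π ⟨$⟩ʳ δ J (minI J)) ≡ δ I (minI I) ×
    ((a : Fin m → A) → f (a ∘ δ I) ≡ f ((a ∘ (π ⟨$⟩ʳ_)) ∘ δ J))

module Deduplication {A : Set} (_≟_ : DecidableEquality A) where

  open DecMembership _≟_ using (_∈?_)

  dedup : List A → List A
  dedup = deduplicate _≟_

  DedupInvariant : {B : Set} → (List A → B) → Set
  DedupInvariant Φ = ∀ {xs ys} → dedup xs ≡ dedup ys → Φ xs ≡ Φ ys

  onDedup : {B : Set} → (Distinct A → B) → List A → B
  onDedup f* xs = f* ⟨ dedup xs ∣ deduplicate-! _≟_ xs ⟩

  onDedup-dedupInvariant : {B : Set} (f* : Distinct A → B) → DedupInvariant (onDedup f*)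
  onDedup-dedupInvariant f* eq = cong f* (⟨∣⟩-cong eq)

  dedup-∷-cong : ∀ {x xs ys} → dedup xs ≡ dedup ys → dedup (x ∷ xs) ≡ dedup (x ∷ ys)
  dedup-∷-cong {x} = cong (λ d → x ∷ filter (¬? ∘ (x ≟_)) d)

  dedup-unique : ∀ {xs} → Unique xs → dedup xs ≡ xs
  dedup-unique {[]}     []           = refl
  dedup-unique {x ∷ xs} (x∉xs ∷ u) =
    cong (x ∷_) (trans (cong (filter x≢?) (dedup-unique u)) (filter-all x≢? x∉xs))
    where x≢? = ¬? ∘ (x ≟_)

  dedup-idem : ∀ xs → dedup (dedup xs) ≡ dedup xs
  dedup-idem xs = dedup-unique (deduplicate-! _≟_ xs)

  mutual
    dedup-∷ʳ-∈ : ∀ {xs y} → y ∈ xs → dedup (xs ∷ʳ y) ≡ dedup xs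
    dedup-∷ʳ-∈ {x ∷ xs} (there y∈xs) = dedup-∷-cong (dedup-∷ʳ-∈ y∈xs)
    dedup-∷ʳ-∈ {x ∷ xs} (here refl) with x ∈? xs
    ... | yes x∈xs = dedup-∷-cong (dedup-∷ʳ-∈ x∈xs)
    ... | no  x∉xs = cong (x ∷_) (begin
      filter x≢? (dedup (xs ∷ʳ x))              ≡⟨ cong (filter x≢?) (dedup-∷ʳ-∉ x∉xs) ⟩
      filter x≢? (dedup xs ++ [ x ])            ≡⟨ filter-++ x≢? (dedup xs) [ x ] ⟩
      filter x≢? (dedup xs) ++ filter x≢? [ x ] ≡⟨ cong (filter x≢? (dedup xs) ++_) (filter-reject x≢? x≢x) ⟩
      filter x≢? (dedup xs) ++ []               ≡⟨ ++-identityʳ _ ⟩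
      filter x≢? (dedup xs)                     ∎)
      where
      x≢? = ¬? ∘ (x ≟_)
      x≢x : ¬ (x ≢ x)
      x≢x x≢x = x≢x refl

    dedup-∷ʳ-∉ : ∀ {xs y} → y ∉ xs → dedup (xs ∷ʳ y) ≡ dedup xs ∷ʳ y
    dedup-∷ʳ-∉ {[]}     _    = refl
    dedup-∷ʳ-∉ {x ∷ xs} {y} y∉ = cong (x ∷_) (begin
      filter x≢? (dedup (xs ∷ʳ y))              ≡⟨ cong (filter x≢?) (dedup-∷ʳ-∉ (y∉ ∘ there)) ⟩
      filter x≢? (dedup xs ++ [ y ])            ≡⟨ filter-++ x≢? (dedup xs) [ y ] ⟩
      filter x≢? (dedup xs) ++ filter x≢? [ y ] ≡⟨ cong (filter x≢? (dedup xs) ++_) (filter-accept x≢? x≢y) ⟩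
      filter x≢? (dedup xs) ++ [ y ]            ∎)
      where
      x≢? = ¬? ∘ (x ≟_)
      x≢y : x ≢ y
      x≢y = y∉ ∘ here ∘ sym

  dedup-++-⊆ : ∀ {xs} ys → ys ⊆ xs → dedup (xs ++ ys) ≡ dedup xs
  dedup-++-⊆ {xs} []       _     = cong dedup (++-identityʳ xs)
  dedup-++-⊆ {xs} (y ∷ ys) ys⊆xs = begin
    dedup (xs ++ y ∷ ys)    ≡⟨ cong dedup (++-assoc xs [ y ] ys) ⟨
    dedup (xs ∷ʳ y ++ ys)   ≡⟨ dedup-++-⊆ ys (λ z∈ → ∈-++⁺ˡ (ys⊆xs (there z∈))) ⟩
    dedup (xs ∷ʳ y)         ≡⟨ dedup-∷ʳ-∈ (ys⊆xs (here refl)) ⟩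
    dedup xs                ∎

  dedup-∷-head : ∀ {xs x r} → dedup xs ≡ x ∷ r → dedup (x ∷ xs) ≡ dedup xs
  dedup-∷-head {xs} {x} {r} eq with x∉r ∷ _ ← subst Unique eq (deduplicate-! _≟_ xs) = begin
    x ∷ filter x≢? (dedup xs) ≡⟨ cong (λ d → x ∷ filter x≢? d) eq ⟩
    x ∷ filter x≢? (x ∷ r)    ≡⟨ cong (x ∷_) (filter-reject x≢? (λ x≢x → x≢x refl)) ⟩
    x ∷ filter x≢? r          ≡⟨ cong (x ∷_) (filter-all x≢? x∉r) ⟩
    x ∷ r                     ≡⟨ eq ⟨
    dedup xs                  ∎
    where x≢? = ¬? ∘ (x ≟_)

  dedup-toList-init : (a : Vector A (suc n)) → last a ∈ toList (init a) →
                      dedup (toList a) ≡ dedup (toList (init a))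
  dedup-toList-init a last∈init = trans (cong dedup (toList-init-last a)) (dedup-∷ʳ-∈ last∈init)

  dedup-toList-padTo : ∀ {d xs} → d ∈ xs → length xs ≤ n → dedup (toList (padTo n d xs)) ≡ dedup xs
  dedup-toList-padTo {n} {d} {xs} d∈xs len = begin
    dedup (toList (padTo n d xs))                ≡⟨ cong dedup (toList-padTo d xs len) ⟩
    dedup (xs ++ toList (λ _ → d))               ≡⟨ dedup-++-⊆ _ padding⊆xs ⟩
    dedup xs                                     ∎
    where
    padding⊆xs : toList {n = n ∸ length xs} (λ _ → d) ⊆ xs
    padding⊆xs z∈ = subst (_∈ xs) (sym (proj₂ (∈-tabulate⁻ z∈))) d∈xs

  dedup-∘δ-last : (i : Fin (suc n)) (i<last : i Fin.< fromℕ n) (a : Vector A n) →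
                  dedup (toList (a ∘ δ ((i , fromℕ n) , i<last))) ≡ dedup (toList a)
  dedup-∘δ-last i i<last a =
    trans (dedup-toList-init (a ∘ δ I) last∈init) (cong dedup init≡a)
    where
    I = (i , fromℕ _) , i<last
    init≡a : toList (init (a ∘ δ I)) ≡ toList a
    init≡a = tabulate-cong λ j → cong a (δ-inject₁ i i<last j)

    last∈init : last (a ∘ δ I) ∈ toList (init (a ∘ δ I))
    last∈init = subst (last (a ∘ δ I) ∈_) (sym init≡a) (∈-tabulate⁺ (δ I (fromℕ _)))

  module FirstToLast {B : Set} (Φ : List A → B) (Φ-dedup : DedupInvariant Φ)
    {L : ℕ} (dedup-short : ∀ xs → length (dedup xs) ≤ L)
    (σ : Permutation′ (suc L)) (σ-first : σ ⟨$⟩ʳ zero ≡ fromℕ L)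
    (Φ-σ : ∀ a → Φ (toList a) ≡ Φ (toList (a ∘ (σ ⟨$⟩ʳ_)))) where

    σˡ-last : σ ⟨$⟩ˡ fromℕ L ≡ zero
    σˡ-last = trans (cong (σ ⟨$⟩ˡ_) (sym σ-first)) (inverseˡ σ)

    swap-head : (w : Vector A L) {x y : A} → x ∈ toList w → y ∈ toList w →
                Φ (x ∷ toList w) ≡ Φ (y ∷ toList w)
    swap-head w {x} {y} x∈w y∈w = begin
      Φ (x ∷ toList w)            ≡⟨ Φ-moved x ⟩
      Φ (toList (moved x))        ≡⟨ Φ-dedup (dedup-toList-init (moved x) (last-moved-∈ x∈w)) ⟩
      Φ (toList (init (moved x))) ≡⟨ cong Φ (tabulate-cong (init-moved x y)) ⟩
      Φ (toList (init (moved y))) ≡⟨ Φ-dedup (dedup-toList-init (moved y) (last-moved-∈ y∈w)) ⟨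
      Φ (toList (moved y))        ≡⟨ Φ-moved y ⟨
      Φ (y ∷ toList w)            ∎
      where
      moved : A → Vector A (suc L)
      moved z = (z ∷ᵥ w) ∘ (σ ⟨$⟩ˡ_)

      Φ-moved : ∀ z → Φ (z ∷ toList w) ≡ Φ (toList (moved z))
      Φ-moved z = trans (cong Φ (tabulate-cong unmoved)) (sym (Φ-σ (moved z)))
        where
        unmoved : z ∷ᵥ w ≗ moved z ∘ (σ ⟨$⟩ʳ_)
        unmoved i = cong (z ∷ᵥ w) (sym (inverseˡ σ))

      init-moved : ∀ z z′ → init (moved z) ≗ init (moved z′)
      init-moved z z′ j with σ ⟨$⟩ˡ inject₁ j in eq
      ... | zero  = contradiction (trans (sym σ-first) (trans (cong (σ ⟨$⟩ʳ_) (sym eq)) (inverseʳ σ)))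
                                  fromℕ≢inject₁
      ... | suc _ = refl

      last-moved-∈ : ∀ {z} → z ∈ toList w → last (moved z) ∈ toList (init (moved z))
      last-moved-∈ z∈w with j , refl ← ∈-tabulate⁻ z∈w =
        subst (_∈ toList (init (moved (w j))))
              (trans (cong (w j ∷ᵥ w) (inverseˡ σ)) (sym (cong (w j ∷ᵥ w) σˡ-last)))
              (∈-toList-init (moved (w j)) {σ ⟨$⟩ʳ suc j} σʳ-suc≢last)
        where
        σʳ-suc≢last : σ ⟨$⟩ʳ suc j ≢ fromℕ L
        σʳ-suc≢last eq = 0≢1+n (trans (sym σˡ-last) (trans (cong (σ ⟨$⟩ˡ_) (sym eq)) (inverseˡ σ)))

    move-to-front : ∀ {xs x} → x ∈ xs → Φ xs ≡ Φ (x ∷ xs)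
    move-to-front {xs} {x} x∈xs with dedup xs in eq | ∈-deduplicate⁺ _≟_ x∈xs
    ... | h ∷ r | x∈hr = begin
      Φ xs             ≡⟨ Φ-dedup (dedup-∷-head eq) ⟨
      Φ (h ∷ xs)       ≡⟨ Φ-dedup (dedup-∷-cong padded) ⟨
      Φ (h ∷ toList w) ≡⟨ swap-head w (∈w (here refl)) (∈w x∈hr) ⟩
      Φ (x ∷ toList w) ≡⟨ Φ-dedup (dedup-∷-cong padded) ⟩
      Φ (x ∷ xs)       ∎
      where
      w : Vector A L
      w = padTo L h (h ∷ r)

      padded : dedup (toList w) ≡ dedup xs
      padded = begin
        dedup (toList w) ≡⟨ dedup-toList-padTo (here refl) (subst (λ d → length d ≤ L) eq (dedup-short xs)) ⟩
        dedup (h ∷ r)    ≡⟨ cong dedup eq ⟨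
        dedup (dedup xs) ≡⟨ dedup-idem xs ⟩
        dedup xs         ∎

      ∈w : ∀ {z} → z ∈ h ∷ r → z ∈ toList w
      ∈w z∈ = ∈-deduplicate⁻ _≟_ (toList w) (subst (_ ∈_) (trans (sym eq) (sym padded)) z∈)

    prepend-⊆ : ∀ {xs} ys → ys ⊆ xs → Φ xs ≡ Φ (ys ++ xs)
    prepend-⊆ []       _     = refl
    prepend-⊆ (y ∷ ys) ys⊆xs = trans (prepend-⊆ ys (λ z∈ → ys⊆xs (there z∈)))
                                     (move-to-front (∈-++⁺ʳ ys (ys⊆xs (here refl))))

    setInvariant : SetInvariant Φ
    setInvariant {xs} {ys} xs∼ys =
      trans (prepend-⊆ ys (Equivalence.from xs∼ys)) (Φ-dedup (dedup-++-⊆ xs (Equivalence.to xs∼ys)))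

module _ {A : Set} {k : ℕ} (e : A ↔ Fin k) where

  open Inverse e using (to; from; strictlyInverseʳ)
  open Deduplication (decEqFin e)

  supp-cong : (a : Vector A n) {n′ : ℕ} (b : Vector A n′) → toList a ∼[ set ] toList b → supp e a ≡ supp e b
  supp-cong a b a∼b = Vec.tabulate-cong λ j →
    does-⇔ (⇔-trans (⇔-sym ∈-toList⇔) (⇔-trans a∼b ∈-toList⇔))
           (any? λ i → decEqFin e (a i) (from j)) (any? λ i → decEqFin e (b i) (from j))

  supp-∘-surjective : (a : Vector A n) {m : ℕ} {g : Fin m → Fin n} →
                      StrictlySurjective _≡_ g → supp e (a ∘ g) ≡ supp e a
  supp-∘-surjective a g-surj = supp-cong (a ∘ _) a (toList-∘-surjective a g-surj)

  ∈-supp : (a : Vector A n) {z : A} → T (lookup (supp e a) (to z)) ⇔ z ∈ toList a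
  ∈-supp a {z} rewrite Vec.lookup∘tabulate (λ j → does (any? λ i → decEqFin e (a i) (from j))) (to z)
                     | strictlyInverseʳ z =
    ⇔-trans (T-does⇔ (any? λ i → decEqFin e (a i) z)) (⇔-sym ∈-toList⇔)

  elements : Subset k → List A
  elements S = filter (λ z → T? (lookup S (to z))) (toList from)

  ∈-elements : {S : Subset k} {z : A} → z ∈ elements S ⇔ T (lookup S (to z))
  ∈-elements {S} {z} = mk⇔ (proj₂ ∘ ∈-filter⁻ S∋? {xs = toList from})
    (∈-filter⁺ S∋? {xs = toList from} (subst (_∈ toList from) (strictlyInverseʳ z) (∈-tabulate⁺ (to z))))
    where S∋? = λ z → T? (lookup S (to z))

  toList∼elements-supp : (a : Vector A n) → toList a ∼[ set ] elements (supp e a)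
  toList∼elements-supp a = ⇔-trans (⇔-sym (∈-supp a)) (⇔-sym (∈-elements {S = supp e a}))

  setInvariant⇒DeterminedBySupp : (f : Vector A n → B) (Φ : List A → B) → (∀ a → f a ≡ Φ (toList a)) →
                                  SetInvariant Φ → DeterminedBySupp e f
  setInvariant⇒DeterminedBySupp f Φ f≡Φ Φ-set =
    Φ ∘ elements , λ a → trans (f≡Φ a) (Φ-set {toList a} (toList∼elements-supp a))

  DeterminedBySupp-cong : {f : Vector A n → B} → DeterminedBySupp e f →
                          {a b : Vector A n} → supp e a ≡ supp e b → f a ≡ f b
  DeterminedBySupp-cong (f′ , f≡f′) {a} {b} eq = trans (f≡f′ a) (trans (cong f′ eq) (sym (f≡f′ b)))

  DeterminedBySupp⇒DeterminedByOfo : {f : Vector A n → B} → DeterminedBySupp e f → DeterminedByOfo e f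
  DeterminedBySupp⇒DeterminedByOfo (f′ , f≡f′) =
    (λ u → f′ (supp e (List.lookup (Distinct.entries u)))) ,
    λ a → trans (f≡f′ a) (cong f′ (supp-cong a _ (∼dedup a)))
    where
    ∼dedup : (a : Vector A n) → toList a ∼[ set ] toList (List.lookup (dedup (toList a)))
    ∼dedup a = ⇔-trans (deduplicate-∈⇔ (decEqFin e)) (≡⇒∼[set] (sym (tabulate-lookup (dedup (toList a)))))

  DeterminedBySupp⇒TotallySymmetric : {f : Vector A n → B} → DeterminedBySupp e f → TotallySymmetric f
  DeterminedBySupp⇒TotallySymmetric s σ a =
    DeterminedBySupp-cong s (sym (supp-∘-surjective a λ j → σ ⟨$⟩ˡ j , inverseʳ σ))

  firstToLast⇒DeterminedBySupp : {f : Vector A n → B} (f* : Distinct A → B) → (∀ a → f a ≡ f* (ofo e a)) →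
    {L : ℕ} → k ≤ L → (σ : Permutation′ (suc L)) → σ ⟨$⟩ʳ zero ≡ fromℕ L →
    (∀ a → onDedup f* (toList a) ≡ onDedup f* (toList (a ∘ (σ ⟨$⟩ʳ_)))) → DeterminedBySupp e f
  firstToLast⇒DeterminedBySupp {f = f} f* f≡f* k≤L σ σ-first σ-invariant =
    setInvariant⇒DeterminedBySupp f (onDedup f*) f≡f*
      (FirstToLast.setInvariant (onDedup f*) (onDedup-dedupInvariant f*)
        dedup-short σ σ-first σ-invariant)
    where
    dedup-short : ∀ xs → length (dedup xs) ≤ _
    dedup-short xs = ≤-trans (unique-length≤ e (deduplicate-! (decEqFin e) xs)) k≤L

  DeterminedBySupp⇒IdentificationMinorsEquivalent : {m : ℕ} {f : Vector A (suc m) → B} →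
    DeterminedBySupp e f → IdentificationMinorsEquivalent f
  DeterminedBySupp⇒IdentificationMinorsEquivalent s I J =
    π , transpose-matchˡ (δ J (minI J)) (δ I (minI I)) , λ a → DeterminedBySupp-cong s (begin
      supp e (a ∘ δ I)                 ≡⟨ supp-∘-surjective a (δ-surjective I) ⟩
      supp e a                         ≡⟨ supp-∘-surjective a (λ j → π ⟨$⟩ˡ j , inverseʳ π) ⟨
      supp e (a ∘ (π ⟨$⟩ʳ_))           ≡⟨ supp-∘-surjective (a ∘ (π ⟨$⟩ʳ_)) (δ-surjective J) ⟨
      supp e ((a ∘ (π ⟨$⟩ʳ_)) ∘ δ J)   ∎)
    where π = transpose (δ J (minI J)) (δ I (minI I))

  -- With I the last two positions and J the first and the last one, π sends the first position
  -- to the last, and a δ_I, a π δ_J are a and a π with a repeated entry appended.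
  IdentificationMinorsEquivalent⇒DeterminedBySupp : {m : ℕ} {f : Vector A (3 + m) → B} → k ≤ suc m →
    DeterminedByOfo e f → IdentificationMinorsEquivalent f → DeterminedBySupp e f
  IdentificationMinorsEquivalent⇒DeterminedBySupp {m = m} {f} k≤ (f* , f≡f*) minors =
    firstToLast⇒DeterminedBySupp f* f≡f* k≤ π π-first π-invariant
    where
    I J : TwoSubset (3 + m)
    I = (inject₁ (fromℕ (suc m)) , fromℕ (2 + m)) , inject₁<fromℕ (fromℕ (suc m))
    J = (zero , fromℕ (2 + m)) , s≤s z≤n

    π = proj₁ (minors I J)

    π-first : π ⟨$⟩ʳ zero ≡ fromℕ (suc m)
    π-first = begin
      π ⟨$⟩ʳ zero          ≡⟨ cong (π ⟨$⟩ʳ_) (δ-inject₁ zero (s≤s z≤n) zero) ⟨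
      π ⟨$⟩ʳ δ J (minI J)  ≡⟨ proj₁ (proj₂ (minors I J)) ⟩
      δ I (minI I)         ≡⟨ δ-inject₁ (minI I) (proj₂ I) (fromℕ (suc m)) ⟩
      fromℕ (suc m)        ∎

    Φ = onDedup f*

    Φ-∘δ : (i : Fin (3 + m)) (i<last : i Fin.< fromℕ (2 + m)) (a : Vector A (2 + m)) →
           Φ (toList (a ∘ δ ((i , fromℕ (2 + m)) , i<last))) ≡ Φ (toList a)
    Φ-∘δ i i<last a = onDedup-dedupInvariant f* {toList (a ∘ δ ((i , fromℕ (2 + m)) , i<last))} {toList a}
                         (dedup-∘δ-last i i<last a)

    π-invariant : ∀ a → Φ (toList a) ≡ Φ (toList (a ∘ (π ⟨$⟩ʳ_)))
    π-invariant a = begin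
      Φ (toList a)                       ≡⟨ Φ-∘δ (minI I) (proj₂ I) a ⟨
      Φ (toList (a ∘ δ I))               ≡⟨ f≡f* (a ∘ δ I) ⟨
      f (a ∘ δ I)                        ≡⟨ proj₂ (proj₂ (minors I J)) a ⟩
      f ((a ∘ (π ⟨$⟩ʳ_)) ∘ δ J)          ≡⟨ f≡f* ((a ∘ (π ⟨$⟩ʳ_)) ∘ δ J) ⟩
      Φ (toList ((a ∘ (π ⟨$⟩ʳ_)) ∘ δ J)) ≡⟨ Φ-∘δ zero (s≤s z≤n) (a ∘ (π ⟨$⟩ʳ_)) ⟩
      Φ (toList (a ∘ (π ⟨$⟩ʳ_)))         ∎

  TwoSetTransitive⇒DeterminedBySupp : {m : ℕ} {f : Vector A (3 + m) → B} → k ≤ suc m →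
    TwoSetTransitive f → DeterminedByOfo e f → DeterminedBySupp e f
  TwoSetTransitive⇒DeterminedBySupp {f = f} k≤ f-trans (f* , f≡f*) =
    firstToLast⇒DeterminedBySupp f* f≡f* (m≤n⇒m≤1+n k≤) σ σ-first λ a →
      trans (sym (f≡f* a)) (trans (σ-invariant a) (f≡f* (a ∘ (σ ⟨$⟩ʳ_))))
    where
    σ = proj₁ (TwoSetTransitive⇒firstToLast f-trans)
    σ-invariant = proj₁ (proj₂ (TwoSetTransitive⇒firstToLast f-trans))
    σ-first = proj₂ (proj₂ (TwoSetTransitive⇒firstToLast f-trans))

proposition3p5 : (A B : Set) (k : ℕ) (e : A ↔ Fin k) → A → B → (m : ℕ) → suc k < suc m →
    (f : (Fin (suc m) → A) → B) →
    let cond-i   = TotallySymmetric f × DeterminedByOfo e f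
        cond-ii  = TwoSetTransitive f × DeterminedByOfo e f
        cond-iii = DeterminedByOfo e f ×
                   ((I J : TwoSubset (suc m)) → Σ (Permutation′ m) λ π →
                      (π ⟨$⟩ʳ δ J (minI J)) ≡ δ I (minI I) ×
                      ((a : Fin m → A) → f (a ∘ δ I) ≡ f ((a ∘ (π ⟨$⟩ʳ_)) ∘ δ J)))
        cond-iv  = DeterminedBySupp e f
    in (cond-i ⇔ cond-ii) × (cond-i ⇔ cond-iii) × (cond-i ⇔ cond-iv)
proposition3p5 A B k e _ _ (suc (suc m)) (s≤s (s≤s k≤)) f =
    mk⇔ i⇒ii (iv⇒i ∘ ii⇒iv)
  , mk⇔ (iv⇒iii ∘ ii⇒iv ∘ i⇒ii) (iv⇒i ∘ iii⇒iv)
  , mk⇔ (ii⇒iv ∘ i⇒ii) iv⇒i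
  where
  Ofo = DeterminedByOfo e f
  Supp = DeterminedBySupp e f

  i⇒ii : TotallySymmetric f × Ofo → TwoSetTransitive f × Ofo
  i⇒ii = Product.map₁ TotallySymmetric⇒TwoSetTransitive

  ii⇒iv : TwoSetTransitive f × Ofo → Supp
  ii⇒iv (f-trans , f-ofo) = TwoSetTransitive⇒DeterminedBySupp e k≤ f-trans f-ofo

  iii⇒iv : Ofo × IdentificationMinorsEquivalent f → Supp
  iii⇒iv (f-ofo , minors) = IdentificationMinorsEquivalent⇒DeterminedBySupp e k≤ f-ofo minors

  iv⇒i : Supp → TotallySymmetric f × Ofo
  iv⇒i s = DeterminedBySupp⇒TotallySymmetric e s , DeterminedBySupp⇒DeterminedByOfo e s

  iv⇒iii : Supp → Ofo × IdentificationMinorsEquivalent f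
  iv⇒iii s = DeterminedBySupp⇒DeterminedByOfo e s , DeterminedBySupp⇒IdentificationMinorsEquivalent e s
proposition3p5 A B zero e a₀ _ (suc zero) _ f with () ← Inverse.to e a₀
proposition3p5 A B (suc k) e _ _ (suc zero) (s≤s (s≤s ())) f
proposition3p5 A B k e _ _ zero (s≤s ()) f
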